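{- Let $T_1$ and $T_2$ be two compatible spanning trees on $L\sqcup R$, where $T_1$ has right degree vector $v$ and $T_2$ has right degree vector $v+e_p-e_q$ for some $p,q\in[d]$. If $(\ell_s,r_p)$ is an edge of $T_1$, then it is also an edge of $T_2$. Furthermore, the degree of $\ell_s$ in $T_1$ is greater than or equal to its degree in $T_2$.
   Context: $L=\{\ell_1,\dots,\ell_n\}$, $R=\{r_1,\dots,r_d\}$. Spanning trees are spanning trees of the complete bipartite graph on $L\sqcup R$, identified with their edge sets. The right degree vector lists the degrees of $r_1,\dots,r_d$. Two forests on $L\sqcup R$ are compatible if, for all $J\subseteq L$, $I\subseteq R$ such that both contain perfect matchings on $J\sqcup I$, those perfect matchings are equal. -}

module Defs where

open import Data.Nat using (ℕ; zero; suc; _+_; _≤_)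
open import Data.Integer using (ℤ; +_; _-_) renaming (_+_ to _+ℤ_)
open import Data.Fin using (Fin)
open import Data.Fin.Subset using (Subset; _∈_)
open import Data.Bool using (Bool; true; false)
open import Data.Sum using (_⊎_; inj₁; inj₂)
open import Data.Product using (Σ; _×_; _,_)
open import Data.Empty using (⊥)
open import Data.List using (List; []; _∷_; _++_; [_]; length)
open import Data.List.Relation.Unary.Linked using (Linked)
open import Data.List.Relation.Unary.Unique.Propositional using (Unique)
open import Relation.Binary.Construct.Closure.ReflexiveTransitive using (Star)
open import Relation.Binary.PropositionalEquality using (_≡_)
open import Relation.Nullary using (¬_; yes; no)
open import Data.Fin using (_≟_)

-- A subgraph of the complete bipartite graph K_{n,d} on L ⊔ R, identified
-- with its edge set: E l r ≡ true iff (ℓ_l , r_r) is an edge.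
Edges : ℕ → ℕ → Set
Edges n d = Fin n → Fin d → Bool

V : ℕ → ℕ → Set
V n d = Fin n ⊎ Fin d

Adj : ∀ {n d} → Edges n d → V n d → V n d → Set
Adj E (inj₁ l) (inj₂ r) = E l r ≡ true
Adj E (inj₂ r) (inj₁ l) = E l r ≡ true
Adj E (inj₁ _) (inj₁ _) = ⊥
Adj E (inj₂ _) (inj₂ _) = ⊥

Connected : ∀ {n d} → Edges n d → Set
Connected {n} {d} E = (u v : V n d) → Star (Adj E) u v

Cycle : ∀ {n d} → Edges n d → Set
Cycle {n} {d} E =
  Σ (V n d) λ u → Σ (List (V n d)) λ ws →
    (2 ≤ length ws) × Unique (u ∷ ws) × Linked (Adj E) (u ∷ ws ++ [ u ])

Acyclic : ∀ {n d} → Edges n d → Set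
Acyclic E = ¬ Cycle E

SpanningTree : ∀ {n d} → Edges n d → Set
SpanningTree E = Connected E × Acyclic E

countTrue : ∀ {k} → (Fin k → Bool) → ℕ
countTrue {zero} f = 0
countTrue {suc k} f with f Fin.zero
... | true  = suc (countTrue (λ i → f (Fin.suc i)))
... | false = countTrue (λ i → f (Fin.suc i))

degL : ∀ {n d} → Edges n d → Fin n → ℕ
degL E l = countTrue (λ r → E l r)

degR : ∀ {n d} → Edges n d → Fin d → ℕ
degR E r = countTrue (λ l → E l r)

e : ∀ {d} → Fin d → Fin d → ℤ
e p r with p ≟ r
... | yes _ = + 1
... | no  _ = + 0

PerfectMatchingIn : ∀ {n d} → Edges n d → Subset n → Subset d → Edges n d → Set
PerfectMatchingIn {n} {d} F J I M =
  ((l : Fin n) (r : Fin d) → M l r ≡ true → (F l r ≡ true) × (l ∈ J) × (r ∈ I))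
  × ((l : Fin n) → l ∈ J → Σ (Fin d) λ r → (M l r ≡ true) × ((r' : Fin d) → M l r' ≡ true → r' ≡ r))
  × ((r : Fin d) → r ∈ I → Σ (Fin n) λ l → (M l r ≡ true) × ((l' : Fin n) → M l' r ≡ true → l' ≡ l))

Compatible : ∀ {n d} → Edges n d → Edges n d → Set
Compatible {n} {d} F₁ F₂ =
  (J : Subset n) (I : Subset d) (M₁ M₂ : Edges n d) →
  PerfectMatchingIn F₁ J I M₁ → PerfectMatchingIn F₂ J I M₂ →
  (l : Fin n) (r : Fin d) → M₁ l r ≡ M₂ l r

module Submission where

-- Call a walk
-- alternating if it leaves left vertices along T₁-edges and right vertices
-- along T₂-edges.
--
-- (1) Compatibility forbids alternating cycles through an edge of T₁ ∖ T₂: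
--     reading such a cycle in its two directions gives perfect matchings on
--     its vertices inside T₁ and inside T₂ that differ at that edge.
-- (2) Every vertex is reached from r_p by an alternating walk.  Grow the set
--     of reached vertices until it is closed; a closed set X containing r_p is
--     everything, by counting edges into X: rooting both trees outside X, the
--     parent edges of X show |X| ≤ e₁(X) and e₂(X) ≤ |X| − 1, while the
--     degree hypothesis gives e₂(X) + [q ∈ X] = e₁(X) + 1.
-- The theorem follows by closing walks r_p ⇝ ℓ_s and r ⇝ r_p ⇝ ℓ_s with the
-- edges ℓ_s r_p and ℓ_s r.

open import Defs
open import Data.Bool using (Bool; true; false; _∧_; _∨_; if_then_else_) renaming (_≟_ to _≟ᵇ_)
open import Data.Bool.Properties using (∨-zeroʳ; ∧-identityʳ)
open import Data.Empty using (⊥; ⊥-elim)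
open import Data.Fin using (Fin; punchIn; _≟_)
open import Data.Fin.Properties using (punchInᵢ≢i; any?)
open import Data.Fin.Subset using (Subset) renaming (_∈_ to _∈ₛ_)
open import Data.Integer using (+_; _-_) renaming (_+_ to _+ℤ_; -_ to -ℤ_)
import Data.Integer.Properties as ℤ
open import Data.List using (List; []; _∷_; _++_; [_]; length)
open import Data.List.Membership.Propositional using (_∈_)
open import Data.List.Membership.Propositional.Properties using (∈-++⁻)
open import Data.List.Relation.Unary.All using ([])
open import Data.List.Relation.Unary.All.Properties using (¬Any⇒All¬; All¬⇒¬Any)
open import Data.List.Relation.Unary.AllPairs using ([]; _∷_)
open import Data.List.Relation.Unary.Any using (here; there)
open import Data.List.Relation.Unary.Linked as Linked using (Linked; [-]; _∷_)
open import Data.List.Relation.Unary.Unique.Propositional using (Unique)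
open import Data.Nat using (ℕ; zero; suc; _+_; _≤_; _<_; z≤n; s≤s; pred)
open import Data.Nat.Properties
  using ( +-0-commutativeMonoid; ≤-refl; ≤-trans; ≤-pred; 1+n≰n; n≤0⇒n≡0; <-asym; m≤n+m
        ; +-comm; +-suc; +-identityʳ; +-mono-≤; +-monoˡ-≤; +-monoʳ-≤; +-mono-<-≤; +-mono-≤-< )
import Data.Nat.Properties
open import Data.Product using (Σ; _×_; _,_; proj₁; proj₂)
open import Data.Sum using (_⊎_; inj₁; inj₂)
open import Data.Sum.Properties using (≡-dec; inj₁-injective; inj₂-injective)
open import Data.Vec using (tabulate)
open import Data.Vec.Properties using (lookup∘tabulate; lookup⇒[]=; []=⇒lookup)
open import Function using (_∘_; flip)
open import Level using (0ℓ)
open import Relation.Binary using (Rel; DecidableEquality)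
open import Relation.Binary.Construct.Closure.ReflexiveTransitive as Star using (Star; ε; _◅_; _◅◅_)
open import Relation.Binary.PropositionalEquality
  using (_≡_; _≢_; refl; sym; trans; cong; cong₂; subst; subst₂)
import Relation.Binary.PropositionalEquality
open import Relation.Nullary using (¬_; Dec; yes; no)
open import Relation.Nullary.Decidable using (isYes; ¬?; _×-dec_; _⊎-dec_)
open import Algebra.Properties.CommutativeMonoid.Sum +-0-commutativeMonoid
  using (sum; sum-remove; sum-cong-≗; sum-replicate-zero; ∑-distrib-+; ∑-comm)

isYes⇒ : ∀ {P : Set} (P? : Dec P) → isYes P? ≡ true → P
isYes⇒ (yes p) _ = p

⇒isYes : ∀ {P : Set} (P? : Dec P) → P → isYes P? ≡ true
⇒isYes (yes _)  _ = refl
⇒isYes (no ¬p) p = ⊥-elim (¬p p)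

∈-tabulate⁺ : ∀ {k} (f : Fin k → Bool) {i} → f i ≡ true → i ∈ₛ tabulate f
∈-tabulate⁺ f {i} fi = lookup⇒[]= i _ (trans (lookup∘tabulate f i) fi)

∈-tabulate⁻ : ∀ {k} (f : Fin k → Bool) {i} → i ∈ₛ tabulate f → f i ≡ true
∈-tabulate⁻ f {i} i∈ = trans (sym (lookup∘tabulate f i)) ([]=⇒lookup i∈)

𝟙 : Bool → ℕ
𝟙 true  = 1
𝟙 false = 0

count : ∀ {k} → (Fin k → Bool) → ℕ
count f = sum (𝟙 ∘ f)

countTrue≡count : ∀ {k} (f : Fin k → Bool) → countTrue f ≡ count f
countTrue≡count {zero}  f = refl
countTrue≡count {suc k} f with f Fin.zero
... | true  = cong suc (countTrue≡count (f ∘ Fin.suc))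
... | false = countTrue≡count (f ∘ Fin.suc)

sum-mono : ∀ {k} {f g : Fin k → ℕ} → (∀ i → f i ≤ g i) → sum f ≤ sum g
sum-mono {zero}  _   = z≤n
sum-mono {suc k} f≤g = +-mono-≤ (f≤g Fin.zero) (sum-mono (f≤g ∘ Fin.suc))

sum-strict : ∀ {k} {f g : Fin k → ℕ} → (∀ i → f i ≤ g i) →
             (i : Fin k) → f i < g i → sum f < sum g
sum-strict {suc k} f≤g Fin.zero    fi<gi = +-mono-≤ fi<gi (sum-mono (f≤g ∘ Fin.suc))
sum-strict {suc k} {f} {g} f≤g (Fin.suc i) fi<gi =
  subst (_≤ sum g) (+-suc (f Fin.zero) _) (+-mono-≤ (f≤g Fin.zero) (sum-strict (f≤g ∘ Fin.suc) i fi<gi))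

sum-single : ∀ {k} (f : Fin k → ℕ) (i : Fin k) → (∀ j → j ≢ i → f j ≡ 0) → sum f ≡ f i
sum-single {suc k} f i off = begin
  sum f                            ≡⟨ sum-remove {i = i} f ⟩
  f i + sum (f ∘ punchIn i)
    ≡⟨ cong (λ z → f i + z) (sum-cong-≗ (λ j → off (punchIn i j) (punchInᵢ≢i i j))) ⟩
  f i + sum {k} (λ _ → 0)          ≡⟨ cong (λ z → f i + z) (sum-replicate-zero k) ⟩
  f i + 0                          ≡⟨ +-comm (f i) 0 ⟩
  f i                              ∎
  where open Relation.Binary.PropositionalEquality.≡-Reasoning

𝟙-mono : ∀ {a b} → (a ≡ true → b ≡ true) → 𝟙 a ≤ 𝟙 b
𝟙-mono {false} _   = z≤n
𝟙-mono {true}  a⇒b rewrite a⇒b refl = ≤-refl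

count-mono : ∀ {k} {f g : Fin k → Bool} → (∀ i → f i ≡ true → g i ≡ true) → count f ≤ count g
count-mono f⊆g = sum-mono (λ i → 𝟙-mono (f⊆g i))

count-strict : ∀ {k} {f g : Fin k → Bool} → (∀ i → f i ≡ true → g i ≡ true) →
               (i : Fin k) → f i ≡ false → g i ≡ true → count f < count g
count-strict f⊆g i fi gi =
  sum-strict (λ j → 𝟙-mono (f⊆g j)) i (subst₂ (λ a b → 𝟙 a < 𝟙 b) (sym fi) (sym gi) ≤-refl)

𝟙≤1 : ∀ b → 𝟙 b ≤ 1
𝟙≤1 true  = ≤-refl
𝟙≤1 false = z≤n

count-none : ∀ {k} → count {k} (λ _ → false) ≡ 0
count-none {k} = sum-replicate-zero k

𝟙-disjoint : ∀ {a b c} → (a ≡ true → c ≡ true) → (b ≡ true → c ≡ true) →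
             (a ≡ true → b ≡ true → ⊥) → 𝟙 a + 𝟙 b ≤ 𝟙 c
𝟙-disjoint {false} {false} _   _   _   = z≤n
𝟙-disjoint {true}  {false} a⇒c _   _   rewrite a⇒c refl = ≤-refl
𝟙-disjoint {false} {true}  _   b⇒c _   rewrite b⇒c refl = ≤-refl
𝟙-disjoint {true}  {true}  _   _   ¬ab = ⊥-elim (¬ab refl refl)

𝟙-cover : ∀ {a b c} → (c ≡ true → (a ≡ true) ⊎ (b ≡ true)) → 𝟙 c ≤ 𝟙 a + 𝟙 b
𝟙-cover {c = false} _ = z≤n
𝟙-cover {a} {c = true} cover with cover refl
... | inj₁ refl = s≤s z≤n
... | inj₂ refl = m≤n+m 1 (𝟙 a)

count-all : ∀ {k} → count {k} (λ _ → true) ≡ k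
count-all {zero}  = refl
count-all {suc k} = cong suc (count-all {k})

data Dir : Set where
  forward backward : Dir

opposite : Dir → Dir
opposite forward  = backward
opposite backward = forward

module _ {A : Set} where

  data Last (x : A) : List A → Set where
    last[] : Last x (x ∷ [])
    last∷  : ∀ {y ys} → Last x ys → Last x (y ∷ ys)

  last-unique : ∀ {a b xs} → Last a xs → Last b xs → a ≡ b
  last-unique last[]     last[]     = refl
  last-unique (last∷ a)  (last∷ b)  = last-unique a b
  last-unique last[]     (last∷ ())
  last-unique (last∷ ()) last[]

  last-∈ : ∀ {a xs} → Last a xs → a ∈ xs
  last-∈ last[]    = here refl
  last-∈ (last∷ l) = there (last-∈ l)

  data Consecutive (a b : A) : List A → Set where
    here  : ∀ {xs} → Consecutive a b (a ∷ b ∷ xs)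
    there : ∀ {x xs} → Consecutive a b xs → Consecutive a b (x ∷ xs)

  consecutive? : DecidableEquality A → ∀ a b xs → Dec (Consecutive a b xs)
  consecutive? _≟_ a b []           = no λ ()
  consecutive? _≟_ a b (x ∷ [])     = no λ { (there ()) }
  consecutive? _≟_ a b (x ∷ y ∷ xs) with a ≟ x | b ≟ y | consecutive? _≟_ a b (y ∷ xs)
  ... | yes refl | yes refl | _      = yes here
  ... | _        | _        | yes c  = yes (there c)
  ... | no a≢x   | _        | no ¬c  = no λ { here → a≢x refl ; (there c) → ¬c c }
  ... | _        | no b≢y   | no ¬c  = no λ { here → b≢y refl ; (there c) → ¬c c }

  consecutive-∈ˡ : ∀ {a b xs} → Consecutive a b xs → a ∈ xs
  consecutive-∈ˡ here      = here refl
  consecutive-∈ˡ (there c) = there (consecutive-∈ˡ c)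

  consecutive-∈ʳ : ∀ {a b xs} → Consecutive a b xs → b ∈ xs
  consecutive-∈ʳ here      = there (here refl)
  consecutive-∈ʳ (there c) = there (consecutive-∈ʳ c)

  consecutive-linked : ∀ {R : Rel A 0ℓ} {a b xs} → Linked R xs → Consecutive a b xs → R a b
  consecutive-linked (r ∷ _)  here      = r
  consecutive-linked (_ ∷ rs) (there c) = consecutive-linked rs c
  consecutive-linked [-]      (there ())

  consecutive-++ : ∀ {a b xs} ys → Consecutive a b xs → Consecutive a b (xs ++ ys)
  consecutive-++ ys here      = here
  consecutive-++ ys (there c) = there (consecutive-++ ys c)

  consecutive-last : ∀ {a z xs} → Last a xs → Consecutive a z (xs ++ [ z ])
  consecutive-last last[]    = here
  consecutive-last (last∷ l) = there (consecutive-last l)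

  consecutive-snoc : ∀ {a b z} xs → Consecutive a b (xs ++ [ z ]) →
                     Consecutive a b xs ⊎ (Last a xs × b ≡ z)
  consecutive-snoc []           (there ())
  consecutive-snoc (x ∷ [])     here              = inj₂ (last[] , refl)
  consecutive-snoc (x ∷ [])     (there (there ()))
  consecutive-snoc (x ∷ y ∷ xs) here              = inj₁ here
  consecutive-snoc (x ∷ y ∷ xs) (there c) with consecutive-snoc (y ∷ xs) c
  ... | inj₁ c′       = inj₁ (there c′)
  ... | inj₂ (l , eq) = inj₂ (last∷ l , eq)

  linked-snoc : ∀ {R : Rel A 0ℓ} {x z xs} → Linked R xs → Last x xs → R x z → Linked R (xs ++ [ z ])
  linked-snoc [-]      last[]     r = r ∷ [-]
  linked-snoc (r′ ∷ l) (last∷ la) r = r′ ∷ linked-snoc l la r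
  linked-snoc [-]      (last∷ ()) r

  successor-exists : ∀ {a z} xs → a ∈ xs → Σ A λ b → Consecutive a b (xs ++ [ z ])
  successor-exists {z = z} (x ∷ [])     (here refl) = z , here
  successor-exists         (x ∷ y ∷ xs) (here refl) = y , here
  successor-exists         (x ∷ xs)     (there a∈) with successor-exists xs a∈
  ... | b , c = b , there c

  predecessor-exists : ∀ {a h} t → a ∈ t → Σ A λ b → Consecutive b a (h ∷ t)
  predecessor-exists {h = h} (x ∷ t) (here refl) = h , here
  predecessor-exists         (x ∷ t) (there a∈) with predecessor-exists t a∈
  ... | b , c = b , there c

  successor-unique : ∀ {a b b′ xs} → Unique xs → Consecutive a b xs → Consecutive a b′ xs → b ≡ b′
  successor-unique _       here      here      = refl
  successor-unique (a∉ ∷ _) here      (there c) = ⊥-elim (All¬⇒¬Any a∉ (consecutive-∈ˡ c))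
  successor-unique (a∉ ∷ _) (there c) here      = ⊥-elim (All¬⇒¬Any a∉ (consecutive-∈ˡ c))
  successor-unique (_ ∷ u) (there c) (there c′) = successor-unique u c c′

  predecessor-unique : ∀ {a b b′ xs} → Unique xs → Consecutive b a xs → Consecutive b′ a xs → b ≡ b′
  predecessor-unique _                here              here              = refl
  predecessor-unique (_ ∷ (a∉ ∷ _))   here              (there here)      = ⊥-elim (All¬⇒¬Any a∉ (here refl))
  predecessor-unique (_ ∷ (a∉ ∷ _))   here              (there (there c)) = ⊥-elim (All¬⇒¬Any a∉ (consecutive-∈ʳ c))
  predecessor-unique (_ ∷ (a∉ ∷ _))   (there here)      here              = ⊥-elim (All¬⇒¬Any a∉ (here refl))
  predecessor-unique (_ ∷ (a∉ ∷ _))   (there (there c)) here              = ⊥-elim (All¬⇒¬Any a∉ (consecutive-∈ʳ c))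
  predecessor-unique (_ ∷ u)          (there c)         (there c′)        = predecessor-unique u c c′

  last-no-successor : ∀ {a b xs} → Unique xs → Last a xs → ¬ Consecutive a b xs
  last-no-successor _        last[]     (there ())
  last-no-successor (a∉ ∷ _) (last∷ la) here      = All¬⇒¬Any a∉ (last-∈ la)
  last-no-successor (_ ∷ u)  (last∷ la) (there c) = last-no-successor u la c

  head-no-predecessor : ∀ {h b t} → Unique (h ∷ t) → ¬ Consecutive b h (h ∷ t)
  head-no-predecessor (h∉ ∷ _) here      = All¬⇒¬Any h∉ (here refl)
  head-no-predecessor (h∉ ∷ _) (there c) = All¬⇒¬Any h∉ (consecutive-∈ʳ c)

  -- A repetition-free R-path from x to y, listed backwards: y ∷ rest ends in x
  -- and each element is R-reached from the next one.
  record Path (R : Rel A 0ℓ) (x y : A) : Set where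
    constructor path
    field
      rest   : List A
      unique : Unique (y ∷ rest)
      linked : Linked (flip R) (y ∷ rest)
      ends   : Last x (y ∷ rest)

  -- Every walk can be shortened to a path: extend the path step by step,
  -- cutting off the loop whenever the walk revisits a vertex.
  module _ (_≟_ : DecidableEquality A) {R : Rel A 0ℓ} where
    open import Data.List.Membership.DecPropositional _≟_ using (_∈?_)

    cut : ∀ {x y z} (P : Path R x y) → z ∈ (y ∷ Path.rest P) → Path R x z
    cut P                                          (here refl) = P
    cut (path []       _       _       _)          (there ())
    cut (path (_ ∷ rs) (_ ∷ u) (_ ∷ l) (last∷ e))  (there z∈)  = cut (path rs u l e) z∈

    extend : ∀ {x y z} → Path R x y → R y z → Path R x z
    extend {y = y} {z} P r with z ∈? (y ∷ Path.rest P)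
    ... | yes z∈ = cut P z∈
    ... | no  z∉ = path (y ∷ rest) (¬Any⇒All¬ _ z∉ ∷ unique) (r ∷ linked) (last∷ ends)
      where open Path P

    extend* : ∀ {x y z} → Path R x y → Star R y z → Path R x z
    extend* P ε       = P
    extend* P (r ◅ w) = extend* (extend P r) w

    simplify : ∀ {x y} → Star R x y → Path R x y
    simplify = extend* (path [] ([] ∷ []) [-] last[])

  Arc : Dir → List A → A → A → Set
  Arc forward  xs a b = Consecutive a b xs
  Arc backward xs a b = Consecutive b a xs

  arc-reverse : ∀ d {xs a b} → Arc d xs a b → Arc (opposite d) xs b a
  arc-reverse forward  c = c
  arc-reverse backward c = c

  arc-unreverse : ∀ d {xs a b} → Arc (opposite d) xs a b → Arc d xs b a
  arc-unreverse forward  c = c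
  arc-unreverse backward c = c

  arc? : DecidableEquality A → ∀ d xs a b → Dec (Arc d xs a b)
  arc? _≟_ forward  xs a b = consecutive? _≟_ a b xs
  arc? _≟_ backward xs a b = consecutive? _≟_ b a xs

  module Cyclic {h x : A} {t : List A} (u : Unique (h ∷ t)) (ends : Last x (h ∷ t)) where

    cycle : List A
    cycle = (h ∷ t) ++ [ h ]

    arc-∈ : ∀ d {a b} → Arc d cycle a b → (a ∈ h ∷ t) × (b ∈ h ∷ t)
    arc-∈ forward  c = on-cycle (consecutive-∈ˡ c) , on-cycle (consecutive-∈ʳ c)
      where
        on-cycle : ∀ {a} → a ∈ cycle → a ∈ h ∷ t
        on-cycle a∈ with ∈-++⁻ (h ∷ t) a∈
        ... | inj₁ a∈′          = a∈′
        ... | inj₂ (here refl)  = here refl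
    arc-∈ backward c with arc-∈ forward c
    ... | b∈ , a∈ = a∈ , b∈

    arc-exists : ∀ d {a} → a ∈ h ∷ t → Σ A (Arc d cycle a)
    arc-exists forward  a∈           = successor-exists (h ∷ t) a∈
    arc-exists backward (here refl)  = x , consecutive-last ends
    arc-exists backward (there a∈) with predecessor-exists {h = h} t a∈
    ... | b , c = b , consecutive-++ [ h ] c

    arc-unique : ∀ d {a b b′} → Arc d cycle a b → Arc d cycle a b′ → b ≡ b′
    arc-unique forward c c′ with consecutive-snoc (h ∷ t) c | consecutive-snoc (h ∷ t) c′
    ... | inj₁ d       | inj₁ d′       = successor-unique u d d′
    ... | inj₁ d       | inj₂ (l , _)  = ⊥-elim (last-no-successor u l d)
    ... | inj₂ (l , _) | inj₁ d′       = ⊥-elim (last-no-successor u l d′)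
    ... | inj₂ (_ , refl) | inj₂ (_ , refl) = refl
    arc-unique backward c c′ with consecutive-snoc (h ∷ t) c | consecutive-snoc (h ∷ t) c′
    ... | inj₁ d          | inj₁ d′          = predecessor-unique u d d′
    ... | inj₁ d          | inj₂ (_ , refl)  = ⊥-elim (head-no-predecessor u d)
    ... | inj₂ (_ , refl) | inj₁ d′          = ⊥-elim (head-no-predecessor u d′)
    ... | inj₂ (l , refl) | inj₂ (l′ , _)    = last-unique l l′

∨-true : ∀ {a b} → a ∨ b ≡ true → (a ≡ true) ⊎ (b ≡ true)
∨-true {true}  _ = inj₁ refl
∨-true {false} e = inj₂ e

∧-true : ∀ {a b} → a ∧ b ≡ true → (a ≡ true) × (b ≡ true)
∧-true {true} {true} _ = refl , refl

-- least f b: the least k with f k ≡ true, provided f b ≡ true.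
least : (ℕ → Bool) → ℕ → ℕ
least f zero    = 0
least f (suc b) = if f 0 then 0 else suc (least (f ∘ suc) b)

least-true : ∀ (f : ℕ → Bool) b → f b ≡ true → f (least f b) ≡ true
least-true f zero    fb = fb
least-true f (suc b) fb with f 0 in f0
... | true  = f0
... | false = least-true (f ∘ suc) b fb

least-min : ∀ (f : ℕ → Bool) b k → f k ≡ true → least f b ≤ k
least-min f zero    k       _  = z≤n
least-min f (suc b) k       fk with f 0 in f0
... | true = z≤n
least-min f (suc b) zero    fk | false with trans (sym fk) f0
... | ()
least-min f (suc b) (suc k) fk | false = s≤s (least-min (f ∘ suc) b k fk)

module _ {n d : ℕ} where

  _≟V_ : DecidableEquality (V n d)
  _≟V_ = ≡-dec _≟_ _≟_

  Alt : Edges n d → Edges n d → V n d → V n d → Set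
  Alt F G (inj₁ l) (inj₂ r) = F l r ≡ true
  Alt F G (inj₂ r) (inj₁ l) = G l r ≡ true
  Alt F G (inj₁ _) (inj₁ _) = ⊥
  Alt F G (inj₂ _) (inj₂ _) = ⊥

  alt-reverse : (F G : Edges n d) {a b : V n d} → Alt F G a b → Alt G F b a
  alt-reverse F G {inj₁ _} {inj₂ _} e = e
  alt-reverse F G {inj₂ _} {inj₁ _} e = e

  -- A repetition-free alternating cycle h ∷ t (closed up by returning to h),
  -- read backwards along Alt F G.  Reading it forward, resp. backward, pairs
  -- every left vertex of the cycle with its neighbour on the cycle; this gives
  -- a perfect matching on the vertices of the cycle contained in G, resp. F.
  module AlternatingCycle (F G : Edges n d) {h x : V n d} {t : List (V n d)}
    (u : Unique (h ∷ t)) (ends : Last x (h ∷ t))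
    (linked : Linked (flip (Alt F G)) ((h ∷ t) ++ [ h ])) where
    open Cyclic u ends
    open import Data.List.Membership.DecPropositional _≟V_ using (_∈?_)

    J : Subset n
    J = tabulate (λ l → isYes (inj₁ l ∈? h ∷ t))

    I : Subset d
    I = tabulate (λ r → isYes (inj₂ r ∈? h ∷ t))

    matching : Dir → Edges n d
    matching dir l r = isYes (arc? _≟V_ dir cycle (inj₁ l) (inj₂ r))

    host : Dir → Edges n d
    host forward  = G
    host backward = F

    arc-edge : ∀ dir l r → Arc dir cycle (inj₁ l) (inj₂ r) → host dir l r ≡ true
    arc-edge forward  l r c = consecutive-linked {R = flip (Alt F G)} linked c
    arc-edge backward l r c = consecutive-linked {R = flip (Alt F G)} linked c

    arc-alternates : ∀ dir {a b} → Arc dir cycle a b → Alt F G a b ⊎ Alt F G b a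
    arc-alternates forward  c = inj₂ (consecutive-linked {R = flip (Alt F G)} linked c)
    arc-alternates backward c = inj₁ (consecutive-linked {R = flip (Alt F G)} linked c)

    no-left-arc : ∀ dir {l l′} → ¬ Arc dir cycle (inj₁ l) (inj₁ l′)
    no-left-arc dir c with arc-alternates dir c
    ... | inj₁ ()
    ... | inj₂ ()

    no-right-arc : ∀ dir {r r′} → ¬ Arc dir cycle (inj₂ r) (inj₂ r′)
    no-right-arc dir c with arc-alternates dir c
    ... | inj₁ ()
    ... | inj₂ ()

    perfect : ∀ dir → PerfectMatchingIn (host dir) J I (matching dir)
    perfect dir = inside , left-partner , right-partner
      where
        arc⇒ : ∀ {l r} → matching dir l r ≡ true → Arc dir cycle (inj₁ l) (inj₂ r)
        arc⇒ = isYes⇒ (arc? _≟V_ dir cycle _ _)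

        ⇒arc : ∀ {l r} → Arc dir cycle (inj₁ l) (inj₂ r) → matching dir l r ≡ true
        ⇒arc = ⇒isYes (arc? _≟V_ dir cycle _ _)

        inside : ∀ l r → matching dir l r ≡ true → (host dir l r ≡ true) × (l ∈ₛ J) × (r ∈ₛ I)
        inside l r m =
          arc-edge dir l r (arc⇒ m) ,
          ∈-tabulate⁺ _ (⇒isYes (inj₁ l ∈? h ∷ t) (proj₁ (arc-∈ dir (arc⇒ m)))) ,
          ∈-tabulate⁺ _ (⇒isYes (inj₂ r ∈? h ∷ t) (proj₂ (arc-∈ dir (arc⇒ m))))

        left-partner : ∀ l → l ∈ₛ J → Σ (Fin d) λ r →
                       (matching dir l r ≡ true) × (∀ r′ → matching dir l r′ ≡ true → r′ ≡ r)
        left-partner l l∈ with arc-exists dir (isYes⇒ (inj₁ l ∈? h ∷ t) (∈-tabulate⁻ _ l∈))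
        ... | inj₁ _ , c = ⊥-elim (no-left-arc dir c)
        ... | inj₂ r , c = r , ⇒arc c , λ r′ m → inj₂-injective (arc-unique dir (arc⇒ m) c)

        right-partner : ∀ r → r ∈ₛ I → Σ (Fin n) λ l →
                        (matching dir l r ≡ true) × (∀ l′ → matching dir l′ r ≡ true → l′ ≡ l)
        right-partner r r∈ with arc-exists (opposite dir) (isYes⇒ (inj₂ r ∈? h ∷ t) (∈-tabulate⁻ _ r∈))
        ... | inj₂ _ , c = ⊥-elim (no-right-arc (opposite dir) c)
        ... | inj₁ l , c = l , ⇒arc (arc-unreverse dir c) ,
          λ l′ m → inj₁-injective (arc-unique (opposite dir) (arc-reverse dir (arc⇒ m)) c)

    compatible-arc : Compatible F G → ∀ {l r} → Arc backward cycle (inj₁ l) (inj₂ r) → G l r ≡ true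
    compatible-arc compatible {l} {r} c =
      arc-edge forward l r (isYes⇒ (arc? _≟V_ forward cycle _ _)
        (trans (sym (compatible J I (matching backward) (matching forward)
                                (perfect backward) (perfect forward) l r))
               (⇒isYes (arc? _≟V_ backward cycle _ _) c)))

  -- An alternating walk from r back to ℓ, closed up by an F-edge ℓr, contains
  -- an alternating cycle through ℓr; so for compatible F, G that edge lies in G.
  alternating-return : (F G : Edges n d) → Compatible F G → ∀ {l r} → F l r ≡ true →
                       Star (Alt F G) (inj₂ r) (inj₁ l) → G l r ≡ true
  alternating-return F G compatible Flr walk with simplify _≟V_ walk
  ... | path _ u linked ends =
    AlternatingCycle.compatible-arc F G u ends (linked-snoc linked ends Flr) compatible
      (consecutive-last ends)

  compatible-sym : {F G : Edges n d} → Compatible F G → Compatible G F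
  compatible-sym compatible J I M₁ M₂ pm₁ pm₂ l r = sym (compatible J I M₂ M₁ pm₂ pm₁ l r)

  _==_ : V n d → V n d → Bool
  u == w = isYes (u ≟V w)

  ==⇒≡ : ∀ {u w} → u == w ≡ true → u ≡ w
  ==⇒≡ {u} {w} = isYes⇒ (u ≟V w)

  ==-refl : ∀ {u} → u == u ≡ true
  ==-refl {u} = ⇒isYes (u ≟V u) refl

  ==-≢ : ∀ {u w} → u ≢ w → u == w ≡ false
  ==-≢ {u} {w} u≢w with u ≟V w
  ... | yes u≡w = ⊥-elim (u≢w u≡w)
  ... | no  _   = refl

  size : (V n d → Bool) → ℕ
  size X = count (X ∘ inj₁) + count (X ∘ inj₂)

  size-strict : ∀ {X Y : V n d → Bool} → (∀ v → X v ≡ true → Y v ≡ true) →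
                ∀ w → X w ≡ false → Y w ≡ true → size X < size Y
  size-strict X⊆Y (inj₁ l) Xw Yw =
    +-mono-<-≤ (count-strict (X⊆Y ∘ inj₁) l Xw Yw) (count-mono (X⊆Y ∘ inj₂))
  size-strict X⊆Y (inj₂ r) Xw Yw =
    +-mono-≤-< (count-mono (X⊆Y ∘ inj₁)) (count-strict (X⊆Y ∘ inj₂) r Xw Yw)

  size-all : size (λ _ → true) ≡ n + d
  size-all = cong₂ _+_ (count-all {n}) (count-all {d})

  insert : V n d → (V n d → Bool) → V n d → Bool
  insert w X v = X v ∨ (v == w)

  insert-new : ∀ w (X : V n d → Bool) → insert w X w ≡ true
  insert-new w X = trans (cong (X w ∨_) ==-refl) (∨-zeroʳ (X w))

  EdgesInto : Edges n d → (V n d → Bool) → ℕ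
  EdgesInto E X = sum (λ r → count (λ l → X (inj₂ r) ∧ E l r))

  adj : Edges n d → V n d → V n d → Bool
  adj E (inj₁ l) (inj₂ r) = E l r
  adj E (inj₂ r) (inj₁ l) = E l r
  adj E (inj₁ _) (inj₁ _) = false
  adj E (inj₂ _) (inj₂ _) = false

  adj⇒Adj : (E : Edges n d) (u w : V n d) → adj E u w ≡ true → Adj E u w
  adj⇒Adj E (inj₁ l) (inj₂ r) e = e
  adj⇒Adj E (inj₂ r) (inj₁ l) e = e

  Adj⇒adj : (E : Edges n d) (u w : V n d) → Adj E u w → adj E u w ≡ true
  Adj⇒adj E (inj₁ l) (inj₂ r) e = e
  Adj⇒adj E (inj₂ r) (inj₁ l) e = e

  adj-sym : (E : Edges n d) (u w : V n d) → adj E u w ≡ true → adj E w u ≡ true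
  adj-sym E (inj₁ l) (inj₂ r) e = e
  adj-sym E (inj₂ r) (inj₁ l) e = e

  choose : (V n d → Bool) → V n d → V n d
  choose f default with any? (λ l → f (inj₁ l) ≟ᵇ true) | any? (λ r → f (inj₂ r) ≟ᵇ true)
  ... | yes (l , _) | _           = inj₁ l
  ... | no _        | yes (r , _) = inj₂ r
  ... | no _        | no _        = default

  choose-spec : ∀ (f : V n d → Bool) default {v} → f v ≡ true → f (choose f default) ≡ true
  choose-spec f default {v} fv
    with any? (λ l → f (inj₁ l) ≟ᵇ true) | any? (λ r → f (inj₂ r) ≟ᵇ true)
  ... | yes (_ , fl) | _            = fl
  ... | no _         | yes (_ , fr) = fr
  choose-spec f default {inj₁ l} fv | no ¬l | no _  = ⊥-elim (¬l (l , fv))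
  choose-spec f default {inj₂ r} fv | no _  | no ¬r = ⊥-elim (¬r (r , fv))

  -- Rooting a connected graph at ρ: the height of v is its distance to ρ, and
  -- every v ≢ ρ has a neighbour, its parent, of smaller height.
  module Rooted (E : Edges n d) (connected : Connected E) (ρ : V n d) where

    -- within k v: v is joined to ρ by a walk of at most k steps;
    -- closer k v u: u is a neighbour of v that is within k of ρ.
    within : ℕ → V n d → Bool
    closer : ℕ → V n d → V n d → Bool
    within zero    v = isYes (v ≟V ρ)
    within (suc k) v = within k v ∨ closer k v (choose (closer k v) v)
    closer k v u = adj E v u ∧ within k u

    walk-within : ∀ {v} → Star (Adj E) v ρ → Σ ℕ λ k → within k v ≡ true
    walk-within ε = 0 , ⇒isYes (ρ ≟V ρ) refl
    walk-within {v} (_◅_ {j = u} e w) with walk-within w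
    ... | k , wk = suc k ,
      trans (cong (within k v ∨_) (choose-spec (closer k v) v (cong₂ _∧_ (Adj⇒adj E v u e) wk)))
            (∨-zeroʳ (within k v))

    height : V n d → ℕ
    height v = least (λ k → within k v) (proj₁ (walk-within (connected v ρ)))

    height-within : ∀ v → within (height v) v ≡ true
    height-within v with walk-within (connected v ρ)
    ... | k , wk = least-true (λ k → within k v) k wk

    height-min : ∀ v k → within k v ≡ true → height v ≤ k
    height-min v = least-min (λ k → within k v) (proj₁ (walk-within (connected v ρ)))

    height-zero : ∀ v → height v ≡ 0 → v ≡ ρ
    height-zero v h≡ = isYes⇒ (v ≟V ρ) (subst (λ k → within k v ≡ true) h≡ (height-within v))

    parent : V n d → V n d
    parent v = choose (closer (pred (height v)) v) v

    parent-spec : ∀ v → v ≢ ρ → (adj E v (parent v) ≡ true) × (height (parent v) < height v)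
    parent-spec v v≢ρ with height v in h≡
    ... | zero  = ⊥-elim (v≢ρ (height-zero v h≡))
    ... | suc k with ∨-true {within k v} (subst (λ k → within k v ≡ true) h≡ (height-within v))
    ...   | inj₁ near = ⊥-elim (1+n≰n (subst (_≤ k) h≡ (height-min v k near)))
    ...   | inj₂ c with ∧-true {adj E v _} c
    ...     | a , w = a , s≤s (height-min _ k w)

    parent-adj : ∀ v → v ≢ ρ → adj E v (parent v) ≡ true
    parent-adj v v≢ρ = proj₁ (parent-spec v v≢ρ)

    parent-lower : ∀ v → v ≢ ρ → height (parent v) < height v
    parent-lower v v≢ρ = proj₂ (parent-spec v v≢ρ)

    parent-induction : (P : V n d → Set) → P ρ → (∀ v → v ≢ ρ → P (parent v) → P v) → ∀ v → P v
    parent-induction P base step v = go _ v ≤-refl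
      where
        go : ∀ k v → height v ≤ k → P v
        go k v h≤ with v ≟V ρ
        ... | yes refl = base
        go zero    v h≤ | no v≢ρ = ⊥-elim (v≢ρ (height-zero v (n≤0⇒n≡0 h≤)))
        go (suc k) v h≤ | no v≢ρ =
          step v v≢ρ (go k (parent v) (≤-pred (≤-trans (parent-lower v v≢ρ) h≤)))

    left-parent : ∀ l → inj₁ l ≢ ρ → Σ (Fin d) λ r → parent (inj₁ l) ≡ inj₂ r
    left-parent l l≢ρ with parent (inj₁ l) | parent-adj (inj₁ l) l≢ρ
    ... | inj₂ r | _ = r , refl

    right-parent : ∀ r → inj₂ r ≢ ρ → Σ (Fin n) λ l → parent (inj₂ r) ≡ inj₁ l
    right-parent r r≢ρ with parent (inj₂ r) | parent-adj (inj₂ r) r≢ρ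
    ... | inj₁ l | _ = l , refl

    ParentEdge : Fin n → Fin d → Set
    ParentEdge l r = (inj₁ l ≢ ρ × parent (inj₁ l) ≡ inj₂ r)
                   ⊎ (inj₂ r ≢ ρ × parent (inj₂ r) ≡ inj₁ l)

    parent-edge? : ∀ l r → Dec (ParentEdge l r)
    parent-edge? l r = (¬? (inj₁ l ≟V ρ) ×-dec (parent (inj₁ l) ≟V inj₂ r))
                       ⊎-dec (¬? (inj₂ r ≟V ρ) ×-dec (parent (inj₂ r) ≟V inj₁ l))

    Avoid : Fin n → Fin d → V n d → V n d → Set
    Avoid l r a b = (adj E a b ≡ true) × ¬ (a ≡ inj₁ l × b ≡ inj₂ r) × ¬ (a ≡ inj₂ r × b ≡ inj₁ l)

    avoid-sym : ∀ {l r a b} → Avoid l r a b → Avoid l r b a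
    avoid-sym {a = a} {b} (e , ¬lr , ¬rl) =
      adj-sym E a b e , (λ { (p , q) → ¬rl (q , p) }) , (λ { (p , q) → ¬lr (q , p) })

    chain-avoids : ∀ {l r} → ¬ ParentEdge l r → ∀ v → Star (Avoid l r) v ρ
    chain-avoids {l} {r} ¬pe = parent-induction (λ v → Star (Avoid l r) v ρ) ε λ v v≢ρ w →
      (parent-adj v v≢ρ , (λ { (refl , p) → ¬pe (inj₁ (v≢ρ , p)) })
                        , (λ { (refl , p) → ¬pe (inj₂ (v≢ρ , p)) })) ◅ w

    avoiding-path-long : ∀ {l r} rest → Last (inj₁ l) (inj₂ r ∷ rest) →
                         Linked (flip (Avoid l r)) (inj₂ r ∷ rest) → 2 ≤ length rest
    avoiding-path-long []          (last∷ ())     _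
    avoiding-path-long (_ ∷ [])    (last∷ last[]) ((_ , ¬lr , _) ∷ _) = ⊥-elim (¬lr (refl , refl))
    avoiding-path-long (_ ∷ _ ∷ _) _              _                   = s≤s (s≤s z≤n)

    -- An edge ℓr that is not a parent edge closes such a path into a cycle.
    non-parent-edge-cycle : ∀ {l r} → E l r ≡ true → ¬ ParentEdge l r → Cycle E
    non-parent-edge-cycle {l} {r} Elr ¬pe
      with simplify _≟V_ (chain-avoids ¬pe (inj₁ l) ◅◅ Star.reverse avoid-sym (chain-avoids ¬pe (inj₂ r)))
    ... | path rest u linked ends =
      inj₂ r , rest , avoiding-path-long rest ends linked , u ,
      linked-snoc (Linked.map (λ {a} {b} s → adj⇒Adj E a b (adj-sym E b a (proj₁ s))) linked) ends Elr

    tree-edge-is-parent-edge : Acyclic E → ∀ l r → E l r ≡ true → ParentEdge l r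
    tree-edge-is-parent-edge acyclic l r Elr with parent-edge? l r
    ... | yes pe  = pe
    ... | no  ¬pe = ⊥-elim (acyclic (non-parent-edge-cycle Elr ¬pe))

    module ParentCount (X : V n d → Bool) (ρ∉X : X ρ ≡ false) where

      non-root : ∀ {v} → X v ≡ true → v ≢ ρ
      non-root Xv refl with trans (sym Xv) ρ∉X
      ... | ()

      LeftClosed RightClosed : Set
      LeftClosed  = ∀ l r → X (inj₁ l) ≡ true → E l r ≡ true → X (inj₂ r) ≡ true
      RightClosed = ∀ l r → X (inj₂ r) ≡ true → E l r ≡ true → X (inj₁ l) ≡ true

      leftParent rightParent : Fin n → Fin d → Bool
      leftParent  l r = X (inj₁ l) ∧ (parent (inj₁ l) == inj₂ r) ∧ X (inj₂ r)
      rightParent l r = X (inj₂ r) ∧ (parent (inj₂ r) == inj₁ l)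

      left-row : ∀ l → count (leftParent l) ≡ 𝟙 (X (inj₁ l) ∧ X (parent (inj₁ l)))
      left-row l with X (inj₁ l) in Xl
      ... | false = count-none {d}
      ... | true with left-parent l (non-root Xl)
      ...   | r , pe rewrite pe = trans (sum-single _ r off) (cong (λ b → 𝟙 (b ∧ X (inj₂ r))) ==-refl)
        where
          off : ∀ r′ → r′ ≢ r → 𝟙 ((inj₂ r == inj₂ r′) ∧ X (inj₂ r′)) ≡ 0
          off r′ r′≢r rewrite ==-≢ {inj₂ r} {inj₂ r′} (λ e → r′≢r (sym (inj₂-injective e))) = refl

      right-column : ∀ r → count (λ l → rightParent l r) ≡ 𝟙 (X (inj₂ r))
      right-column r with X (inj₂ r) in Xr
      ... | false = count-none {n}
      ... | true with right-parent r (non-root Xr)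
      ...   | l , pe rewrite pe = trans (sum-single _ l off) (cong 𝟙 ==-refl)
        where
          off : ∀ l′ → l′ ≢ l → 𝟙 (inj₁ l == inj₁ l′) ≡ 0
          off l′ l′≢l rewrite ==-≢ {inj₁ l} {inj₁ l′} (λ e → l′≢l (sym (inj₁-injective e))) = refl

      -- Parent edges inside X, counted by their lower endpoint.
      ParentEdgesInX : ℕ
      ParentEdgesInX = count (λ l → X (inj₁ l) ∧ X (parent (inj₁ l))) + count (X ∘ inj₂)

      parent-edge-total :
        sum (λ r → sum (λ l → 𝟙 (leftParent l r) + 𝟙 (rightParent l r))) ≡ ParentEdgesInX
      parent-edge-total = begin
        sum (λ r → sum (λ l → 𝟙 (leftParent l r) + 𝟙 (rightParent l r)))
          ≡⟨ sum-cong-≗ (λ r → ∑-distrib-+ (λ l → 𝟙 (leftParent l r)) (λ l → 𝟙 (rightParent l r))) ⟩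
        sum (λ r → count (λ l → leftParent l r) + count (λ l → rightParent l r))
          ≡⟨ ∑-distrib-+ (λ r → count (λ l → leftParent l r)) (λ r → count (λ l → rightParent l r)) ⟩
        sum (λ r → count (λ l → leftParent l r)) + sum (λ r → count (λ l → rightParent l r))
          ≡⟨ cong (_+ sum (λ r → count (λ l → rightParent l r))) (sym (∑-comm (λ l r → 𝟙 (leftParent l r)))) ⟩
        sum (λ l → count (leftParent l)) + sum (λ r → count (λ l → rightParent l r))
          ≡⟨ cong₂ _+_ (sum-cong-≗ left-row) (sum-cong-≗ right-column) ⟩
        ParentEdgesInX ∎
        where open Relation.Binary.PropositionalEquality.≡-Reasoning

      -- Each parent edge counted lies in E and has its right end in X, and no
      -- edge is the parent edge of both its ends (heights decrease).
      left⇒edge : ∀ l r → leftParent l r ≡ true → X (inj₂ r) ∧ E l r ≡ true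
      left⇒edge l r e with ∧-true {X (inj₁ l)} e
      ... | Xl , e′ with ∧-true {parent (inj₁ l) == inj₂ r} e′
      ...   | pe , Xr = cong₂ _∧_ Xr
                          (subst (λ w → adj E (inj₁ l) w ≡ true) (==⇒≡ pe) (parent-adj (inj₁ l) (non-root Xl)))

      right⇒edge : ∀ l r → rightParent l r ≡ true → X (inj₂ r) ∧ E l r ≡ true
      right⇒edge l r e with ∧-true {X (inj₂ r)} e
      ... | Xr , pe = cong₂ _∧_ Xr
                        (subst (λ w → adj E (inj₂ r) w ≡ true) (==⇒≡ pe) (parent-adj (inj₂ r) (non-root Xr)))

      not-both : ∀ l r → leftParent l r ≡ true → rightParent l r ≡ true → ⊥
      not-both l r el er with ∧-true {X (inj₁ l)} el | ∧-true {X (inj₂ r)} er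
      ... | Xl , el′ | Xr , pr with ∧-true {parent (inj₁ l) == inj₂ r} el′
      ...   | pl , _ = <-asym (subst (λ w → height w < height (inj₁ l)) (==⇒≡ pl) (parent-lower (inj₁ l) (non-root Xl)))
                              (subst (λ w → height w < height (inj₂ r)) (==⇒≡ pr) (parent-lower (inj₂ r) (non-root Xr)))

      parent-edges≤edges : ParentEdgesInX ≤ EdgesInto E X
      parent-edges≤edges = subst (_≤ EdgesInto E X) parent-edge-total
        (sum-mono λ r → sum-mono λ l → 𝟙-disjoint (left⇒edge l r) (right⇒edge l r) (not-both l r))

      -- In a tree, an edge into a right-closed X is a parent edge inside X.
      edges≤parent-edges : Acyclic E → RightClosed → EdgesInto E X ≤ ParentEdgesInX
      edges≤parent-edges acyclic closed = subst (EdgesInto E X ≤_) parent-edge-total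
        (sum-mono λ r → sum-mono λ l → 𝟙-cover (covered l r))
        where
          covered : ∀ l r → X (inj₂ r) ∧ E l r ≡ true → (leftParent l r ≡ true) ⊎ (rightParent l r ≡ true)
          covered l r e with ∧-true {X (inj₂ r)} e
          ... | Xr , Elr with tree-edge-is-parent-edge acyclic l r Elr
          ...   | inj₁ (_ , pe) =
            inj₁ (cong₂ _∧_ (closed l r Xr Elr) (cong₂ _∧_ (trans (cong (_== inj₂ r) pe) ==-refl) Xr))
          ...   | inj₂ (_ , pe) = inj₂ (cong₂ _∧_ Xr (trans (cong (_== inj₁ l) pe) ==-refl))

      -- For a right-closed X, following parents from a vertex of X (towards the
      -- root, outside X) leaves X through the parent edge of a left vertex.
      exit-left : RightClosed → ∀ v → X v ≡ true →
                  Σ (Fin n) λ l → (X (inj₁ l) ≡ true) × (X (parent (inj₁ l)) ≡ false)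
      exit-left closed = parent-induction P (λ Xρ → ⊥-elim (non-root Xρ refl)) step
        where
          P : V n d → Set
          P v = X v ≡ true → Σ (Fin n) λ l → (X (inj₁ l) ≡ true) × (X (parent (inj₁ l)) ≡ false)

          step : ∀ v → v ≢ ρ → P (parent v) → P v
          step v v≢ρ ih Xv with X (parent v) in Xpv
          ... | true = ih refl
          step (inj₁ l) _   _ Xl | false = l , Xl , Xpv
          step (inj₂ r) r≢ρ _ Xr | false with right-parent r r≢ρ
          ... | l , pe with trans (sym (closed l r Xr Elr)) (trans (cong X (sym pe)) Xpv)
            where
              Elr : E l r ≡ true
              Elr = subst (λ w → adj E (inj₂ r) w ≡ true) pe (parent-adj (inj₂ r) r≢ρ)
          ...   | ()

      -- Every vertex of a left-closed X has its parent edge inside X ...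
      left-closed-count : LeftClosed → size X ≤ ParentEdgesInX
      left-closed-count closed = +-monoˡ-≤ (count (X ∘ inj₂)) (count-mono parent-in-X)
        where
          parent-in-X : ∀ l → X (inj₁ l) ≡ true → X (inj₁ l) ∧ X (parent (inj₁ l)) ≡ true
          parent-in-X l Xl with left-parent l (non-root Xl)
          ... | r , pe = cong₂ _∧_ Xl (subst (λ w → X w ≡ true) (sym pe) (closed l r Xl
                            (subst (λ w → adj E (inj₁ l) w ≡ true) pe (parent-adj (inj₁ l) (non-root Xl)))))

      -- ... while for a nonempty right-closed X some left vertex has not.
      right-closed-count : RightClosed → ∀ v → X v ≡ true → ParentEdgesInX < size X
      right-closed-count closed v Xv with exit-left closed v Xv
      ... | l , Xl , Xpl = +-mono-<-≤ (count-strict (λ _ e → proj₁ (∧-true e)) l (cong₂ _∧_ Xl Xpl) Xl) ≤-refl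

-- The hypothesis on right degree vectors, read in ℕ: with δ p r = [p = r],
-- deg₂ r + δ q r = deg₁ r + δ p r.
δ : ∀ {d} → Fin d → Fin d → ℕ
δ p r = 𝟙 (isYes (p ≟ r))

e≡δ : ∀ {d} (p r : Fin d) → e p r ≡ + δ p r
e≡δ p r with p ≟ r
... | yes _ = refl
... | no  _ = refl

degree-shift : ∀ {d} (a b : ℕ) (p q r : Fin d) →
               + a ≡ (+ b +ℤ e p r) - e q r → a + δ q r ≡ b + δ p r
degree-shift a b p q r hyp = ℤ.+-injective (begin
  + a +ℤ + δ q r                          ≡⟨ cong₂ _+ℤ_ hyp (sym (e≡δ q r)) ⟩
  ((+ b +ℤ e p r) - e q r) +ℤ e q r       ≡⟨ ℤ.+-assoc (+ b +ℤ e p r) (-ℤ e q r) (e q r) ⟩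
  (+ b +ℤ e p r) +ℤ (-ℤ e q r +ℤ e q r)   ≡⟨ cong ((+ b +ℤ e p r) +ℤ_) (ℤ.+-inverseˡ (e q r)) ⟩
  (+ b +ℤ e p r) +ℤ + 0                   ≡⟨ ℤ.+-identityʳ (+ b +ℤ e p r) ⟩
  + b +ℤ e p r                            ≡⟨ cong (+ b +ℤ_) (e≡δ p r) ⟩
  + (b + δ p r)                           ∎)
  where open Relation.Binary.PropositionalEquality.≡-Reasoning

module _ {n d : ℕ} (T₁ T₂ : Edges n d) (tree₁ : SpanningTree T₁) (tree₂ : SpanningTree T₂) (p q : Fin d)
  (degrees : (r : Fin d) → + degR T₂ r ≡ (+ degR T₁ r +ℤ e p r) - e q r) where

  degree-balance : ∀ (X : V n d → Bool) → X (inj₂ p) ≡ true →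
                   EdgesInto T₂ X + 𝟙 (X (inj₂ q)) ≡ EdgesInto T₁ X + 1
  degree-balance X Xp = begin
    EdgesInto T₂ X + 𝟙 (X (inj₂ q))            ≡⟨ cong (λ z → EdgesInto T₂ X + z) (sym (in-X q)) ⟩
    EdgesInto T₂ X + sum (λ r → marks q r)     ≡⟨ sym (∑-distrib-+ _ (marks q)) ⟩
    sum (λ r → into T₂ r + marks q r)          ≡⟨ sum-cong-≗ pointwise ⟩
    sum (λ r → into T₁ r + marks p r)          ≡⟨ ∑-distrib-+ _ (marks p) ⟩
    EdgesInto T₁ X + sum (λ r → marks p r)
      ≡⟨ cong (λ z → EdgesInto T₁ X + z) (trans (in-X p) (cong 𝟙 Xp)) ⟩
    EdgesInto T₁ X + 1                         ∎
    where
      open Relation.Binary.PropositionalEquality.≡-Reasoning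

      into : Edges n d → Fin d → ℕ
      into T r = count (λ l → X (inj₂ r) ∧ T l r)

      marks : Fin d → Fin d → ℕ
      marks a r = 𝟙 (X (inj₂ r) ∧ isYes (a ≟ r))

      in-X : ∀ a → sum (marks a) ≡ 𝟙 (X (inj₂ a))
      in-X a = trans (sum-single (marks a) a off)
                     (trans (cong (λ b → 𝟙 (X (inj₂ a) ∧ b)) (⇒isYes (a ≟ a) refl)) (cong 𝟙 (∧-identityʳ _)))
        where
          off : ∀ r → r ≢ a → marks a r ≡ 0
          off r r≢a with X (inj₂ r) | a ≟ r
          ... | _     | yes a≡r = ⊥-elim (r≢a (sym a≡r))
          ... | false | no  _   = refl
          ... | true  | no  _   = refl

      pointwise : ∀ r → into T₂ r + marks q r ≡ into T₁ r + marks p r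
      pointwise r with X (inj₂ r)
      ... | false = refl
      ... | true  = subst₂ (λ a b → a + δ q r ≡ b + δ p r)
                      (countTrue≡count (λ l → T₂ l r)) (countTrue≡count (λ l → T₁ l r))
                      (degree-shift (degR T₂ r) (degR T₁ r) p q r (degrees r))

  Closed : (V n d → Bool) → Set
  Closed X = ∀ {a b} → Alt T₁ T₂ a b → X a ≡ true → X b ≡ true

  -- Root both trees at a vertex
  -- y ∉ X.  Every vertex of X has its T₁-parent edge inside X, T₂ has at most
  -- |X| − 1 edges into X, and by the degree balance T₁ has at most as many:
  --   e₁(X) + 1 = e₂(X) + [q ∈ X] ≤ e₂(X) + 1 ≤ |X| ≤ e₁(X).
  closed-full : ∀ X → X (inj₂ p) ≡ true → Closed X → ∀ v → X v ≡ true
  closed-full X Xp closed y with X y in Xy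
  ... | true  = refl
  ... | false = ⊥-elim (1+n≰n (begin
    suc (EdgesInto T₁ X)              ≡⟨ +-comm 1 (EdgesInto T₁ X) ⟩
    EdgesInto T₁ X + 1                ≡⟨ sym (degree-balance X Xp) ⟩
    EdgesInto T₂ X + 𝟙 (X (inj₂ q))   ≤⟨ +-monoʳ-≤ (EdgesInto T₂ X) (𝟙≤1 (X (inj₂ q))) ⟩
    EdgesInto T₂ X + 1                ≡⟨ +-comm (EdgesInto T₂ X) 1 ⟩
    suc (EdgesInto T₂ X)              ≤⟨ s≤s (C₂.edges≤parent-edges (proj₂ tree₂) right-closed) ⟩
    suc C₂.ParentEdgesInX             ≤⟨ C₂.right-closed-count right-closed (inj₂ p) Xp ⟩
    size X                            ≤⟨ C₁.left-closed-count left-closed ⟩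
    C₁.ParentEdgesInX                 ≤⟨ C₁.parent-edges≤edges ⟩
    EdgesInto T₁ X                    ∎))
    where
      open Data.Nat.Properties.≤-Reasoning
      module C₁ = Rooted.ParentCount T₁ (proj₁ tree₁) y X Xy
      module C₂ = Rooted.ParentCount T₂ (proj₁ tree₂) y X Xy

      left-closed : C₁.LeftClosed
      left-closed l r Xl e = closed {inj₁ l} {inj₂ r} e Xl

      right-closed : C₂.RightClosed
      right-closed l r Xr e = closed {inj₂ r} {inj₁ l} e Xr

  Exit : (V n d → Bool) → Set
  Exit S = Σ (V n d) λ a → Σ (V n d) λ b → Alt T₁ T₂ a b × (S a ≡ true) × (S b ≡ false)

  exit-or-closed : ∀ S → Exit S ⊎ Closed S
  exit-or-closed S
    with any? (λ l → any? (λ r → (S (inj₁ l) ≟ᵇ true) ×-dec (T₁ l r ≟ᵇ true) ×-dec (S (inj₂ r) ≟ᵇ false)))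
       | any? (λ l → any? (λ r → (S (inj₂ r) ≟ᵇ true) ×-dec (T₂ l r ≟ᵇ true) ×-dec (S (inj₁ l) ≟ᵇ false)))
  ... | yes (l , r , Sl , e , Sr) | _                          = inj₁ (inj₁ l , inj₂ r , e , Sl , Sr)
  ... | no _                      | yes (l , r , Sr , e , Sl)  = inj₁ (inj₂ r , inj₁ l , e , Sr , Sl)
  ... | no ¬forward               | no ¬backward               = inj₂ closed
    where
      closed : Closed S
      closed {inj₁ l} {inj₂ r} e Sl with S (inj₂ r) in Sr
      ... | true  = refl
      ... | false = ⊥-elim (¬forward (l , r , Sl , e , Sr))
      closed {inj₂ r} {inj₁ l} e Sr with S (inj₁ l) in Sl
      ... | true  = refl
      ... | false = ⊥-elim (¬backward (l , r , Sr , e , Sl))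

  Reachable : V n d → Set
  Reachable = Star (Alt T₁ T₂) (inj₂ p)

  -- Saturation: starting from a set S of reachable vertices containing r_p,
  -- add the endpoint of an exit until S is closed, hence everything; the
  -- fuel k bounds the number of vertices still missing from S.
  saturate : ∀ k S → S (inj₂ p) ≡ true → (∀ v → S v ≡ true → Reachable v) →
             n + d ≤ size S + k → ∀ v → Reachable v
  saturate k S Sp reach fuel with exit-or-closed S
  ... | inj₂ closed = λ v → reach v (closed-full S Sp closed v)
  saturate zero    S Sp reach fuel | inj₁ (_ , b , _ , _ , Sb) =
    ⊥-elim (1+n≰n (≤-trans (subst (size S <_) (size-all {n} {d}) missing) (subst (n + d ≤_) (+-identityʳ (size S)) fuel)))
    where
      missing : size S < size {n} {d} (λ _ → true)
      missing = size-strict {X = S} (λ _ _ → refl) b Sb refl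
  saturate (suc k) S Sp reach fuel | inj₁ (a , b , step , Sa , Sb) =
    saturate k (insert b S) (cong (_∨ (inj₂ p == b)) Sp) reach′
      (≤-trans fuel (subst (_≤ size (insert b S) + k) (sym (+-suc (size S) k)) (+-monoˡ-≤ k grown)))
    where
      grown : size S < size (insert b S)
      grown = size-strict {X = S} (λ v Sv → cong (_∨ (v == b)) Sv) b Sb (insert-new b S)

      reach′ : ∀ v → insert b S v ≡ true → Reachable v
      reach′ v Sv with ∨-true {S v} Sv
      ... | inj₁ S∋v = reach v S∋v
      ... | inj₂ v=b = subst Reachable (sym (==⇒≡ v=b)) (reach a Sa ◅◅ (step ◅ ε))

  all-reachable : ∀ v → Reachable v
  all-reachable = saturate (n + d) (_== inj₂ p) ==-refl (λ v e → subst Reachable (sym (==⇒≡ e)) ε)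
                           (m≤n+m (n + d) (size {n} {d} (_== inj₂ p)))

-- Closing the walk r_p ⇝ ℓ_s with the T₁-edge ℓ_s r_p shows that this edge is
-- in T₂; reversing the walk r_p ⇝ r, preceded by that edge, closes every
-- T₂-edge ℓ_s r into an alternating cycle of (T₂, T₁), so it is in T₁.
lemma2p11 : (n d : ℕ) (T₁ T₂ : Edges n d) →
    SpanningTree T₁ → SpanningTree T₂ → Compatible T₁ T₂ →
    (p q : Fin d) →
    ((r : Fin d) → + degR T₂ r ≡ (+ degR T₁ r +ℤ e p r) - e q r) →
    (s : Fin n) → T₁ s p ≡ true →
    (T₂ s p ≡ true) × (degL T₂ s ≤ degL T₁ s)
lemma2p11 n d T₁ T₂ tree₁ tree₂ compatible p q degrees s T₁sp = T₂sp , degL-mono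
  where
    reachable : ∀ v → Star (Alt T₁ T₂) (inj₂ p) v
    reachable = all-reachable T₁ T₂ tree₁ tree₂ p q degrees

    T₂sp : T₂ s p ≡ true
    T₂sp = alternating-return T₁ T₂ compatible T₁sp (reachable (inj₁ s))

    T₂⊆T₁ : ∀ r → T₂ s r ≡ true → T₁ s r ≡ true
    T₂⊆T₁ r T₂sr = alternating-return T₂ T₁ (compatible-sym compatible) T₂sr
                     (Star.reverse (alt-reverse T₁ T₂) (T₁sp ◅ reachable (inj₂ r)))

    degL-mono : degL T₂ s ≤ degL T₁ s
    degL-mono = subst₂ _≤_ (sym (countTrue≡count (T₂ s))) (sym (countTrue≡count (T₁ s)))
                       (count-mono T₂⊆T₁)
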